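{- Let $\mathcal{C}$ be a locally finitely presentable category and $H\colon\mathcal{C}\to\mathcal{C}$ a finitary functor preserving non-empty monomorphisms. Assume moreover that every finitely presentable object of $\mathcal{C}$ is a strong quotient of a finitely presentable projective object, and that $H$ preserves strong epimorphisms. Then every $H$-coalgebra with finitely generated carrier is the codomain of a coalgebra homomorphism, with strong epimorphic underlying morphism, from an $H$-coalgebra with finitely presentable carrier.
   Context: A functor is finitary if it preserves filtered colimits. An object $C$ is finitely presentable (fp) if $\mathcal{C}(C,-)$ preserves filtered colimits and finitely generated (fg) if $\mathcal{C}(C,-)$ preserves directed colimits of monomorphisms. A monomorphism is non-empty if its domain is not a strict initial object (an initial object into which every morphism is an isomorphism). An object $X$ is projective if for every strong epimorphism $e\colon A\twoheadrightarrow B$ and every $f\colon X\to B$ there is $f'\colon X\to A$ with $e\cdot f'=f$. A strong quotient of $X$ is given by a strong epimorphism $X\twoheadrightarrow Y$. -}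

module Defs where

open import Level using (Level; _⊔_; 0ℓ) renaming (suc to lsuc)
open import Data.Product using (Σ; _×_; _,_; Σ-syntax)
open import Relation.Binary using (Rel; IsEquivalence; Setoid)
open import Relation.Binary.PropositionalEquality using (_≡_)
open import Relation.Nullary using (¬_)

record Category (o ℓ e : Level) : Set (lsuc (o ⊔ ℓ ⊔ e)) where
  infixr 9 _∘_
  infix  4 _≈_
  field
    Obj : Set o
    _⇒_ : Obj → Obj → Set ℓ
    _≈_ : ∀ {A B} → Rel (A ⇒ B) e
    id  : ∀ {A} → A ⇒ A
    _∘_ : ∀ {A B C} → B ⇒ C → A ⇒ B → A ⇒ C
    assoc     : ∀ {A B C D} {f : A ⇒ B} {g : B ⇒ C} {h : C ⇒ D} →
                (h ∘ g) ∘ f ≈ h ∘ (g ∘ f)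
    identityˡ : ∀ {A B} {f : A ⇒ B} → id ∘ f ≈ f
    identityʳ : ∀ {A B} {f : A ⇒ B} → f ∘ id ≈ f
    equiv     : ∀ {A B} → IsEquivalence (_≈_ {A} {B})
    ∘-resp-≈  : ∀ {A B C} {f h : B ⇒ C} {g i : A ⇒ B} →
                f ≈ h → g ≈ i → f ∘ g ≈ h ∘ i

  module Equivalence {A B : Obj} = IsEquivalence (equiv {A} {B})

  homSetoid : Obj → Obj → Setoid ℓ e
  homSetoid A B = record { Carrier = A ⇒ B ; _≈_ = _≈_ ; isEquivalence = equiv }

record Functor {o ℓ e o′ ℓ′ e′ : Level}
               (C : Category o ℓ e) (D : Category o′ ℓ′ e′)
               : Set (o ⊔ ℓ ⊔ e ⊔ o′ ⊔ ℓ′ ⊔ e′) where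
  private
    module C = Category C
    module D = Category D
  field
    F₀ : C.Obj → D.Obj
    F₁ : ∀ {A B} → A C.⇒ B → F₀ A D.⇒ F₀ B
    identity     : ∀ {A} → F₁ (C.id {A}) D.≈ D.id
    homomorphism : ∀ {X Y Z} {f : X C.⇒ Y} {g : Y C.⇒ Z} →
                   F₁ (g C.∘ f) D.≈ F₁ g D.∘ F₁ f
    F-resp-≈     : ∀ {A B} {f g : A C.⇒ B} → f C.≈ g → F₁ f D.≈ F₁ g

module _ {o ℓ e : Level} (C : Category o ℓ e) where
  open Category C

  Mono : ∀ {A B} → A ⇒ B → Set (o ⊔ ℓ ⊔ e)
  Mono {A} m = ∀ {X} (g h : X ⇒ A) → m ∘ g ≈ m ∘ h → g ≈ h

  Epi : ∀ {A B} → A ⇒ B → Set (o ⊔ ℓ ⊔ e)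
  Epi {B = B} p = ∀ {X} (g h : B ⇒ X) → g ∘ p ≈ h ∘ p → g ≈ h

  IsIso : ∀ {A B} → A ⇒ B → Set (ℓ ⊔ e)
  IsIso {A} {B} f = Σ[ g ∈ B ⇒ A ] ((g ∘ f ≈ id) × (f ∘ g ≈ id))

  StrongEpi : ∀ {A B} → A ⇒ B → Set (o ⊔ ℓ ⊔ e)
  StrongEpi {A} {B} p =
    Epi p ×
    (∀ {X Y} (m : X ⇒ Y) → Mono m → (f : A ⇒ X) (g : B ⇒ Y) →
       g ∘ p ≈ m ∘ f → Σ[ d ∈ B ⇒ X ] ((d ∘ p ≈ f) × (m ∘ d ≈ g)))

  IsInitial : Obj → Set (o ⊔ ℓ ⊔ e)
  IsInitial I = ∀ X → Σ[ f ∈ I ⇒ X ] (∀ (g : I ⇒ X) → g ≈ f)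

  IsStrictInitial : Obj → Set (o ⊔ ℓ ⊔ e)
  IsStrictInitial I = IsInitial I × (∀ {X} (f : X ⇒ I) → IsIso f)

  NonEmptyMono : ∀ {A B} → A ⇒ B → Set (o ⊔ ℓ ⊔ e)
  NonEmptyMono {A} m = Mono m × ¬ IsStrictInitial A

  Projective : Obj → Set (o ⊔ ℓ ⊔ e)
  Projective X = ∀ {A B} (p : A ⇒ B) → StrongEpi p → (f : X ⇒ B) →
                 Σ[ f′ ∈ X ⇒ A ] (p ∘ f′ ≈ f)

module _ {o′ ℓ′ e′ o ℓ e : Level} {J : Category o′ ℓ′ e′} {C : Category o ℓ e} where
  private
    module J = Category J
  open Category C
  open Functor

  record Cocone (D : Functor J C) : Set (o′ ⊔ ℓ′ ⊔ o ⊔ ℓ ⊔ e) where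
    field
      N : Obj
      ψ : ∀ j → F₀ D j ⇒ N
      commute : ∀ {i j} (u : i J.⇒ j) → ψ j ∘ F₁ D u ≈ ψ i

  open Cocone

  IsColimit : {D : Functor J C} → Cocone D → Set (o′ ⊔ ℓ′ ⊔ o ⊔ ℓ ⊔ e)
  IsColimit {D} K = ∀ (K′ : Cocone D) →
    Σ[ u ∈ N K ⇒ N K′ ]
      ((∀ j → u ∘ ψ K j ≈ ψ K′ j) ×
       (∀ (v : N K ⇒ N K′) → (∀ j → v ∘ ψ K j ≈ ψ K′ j) → v ≈ u))

  -- The hom-functor C(X,-) sends the cocone K to a colimit cocone in
  -- setoids (Setoid ℓ e plays the role of Set, the hom-sets being setoids).
  HomPreservesColimit : (X : Obj) {D : Functor J C} → Cocone D →
                        Set (o′ ⊔ ℓ′ ⊔ lsuc (ℓ ⊔ e))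
  HomPreservesColimit X {D} K =
    ∀ (S : Setoid ℓ e) →
    let open Setoid S renaming (Carrier to |S|; _≈_ to _≈S_) in
    (φ : ∀ j → X ⇒ F₀ D j → |S|) →
    (∀ j {f g : X ⇒ F₀ D j} → f ≈ g → φ j f ≈S φ j g) →
    (∀ {i j} (u : i J.⇒ j) (f : X ⇒ F₀ D i) → φ j (F₁ D u ∘ f) ≈S φ i f) →
    Σ[ w ∈ (X ⇒ N K → |S|) ]
      ((∀ {f g : X ⇒ N K} → f ≈ g → w f ≈S w g) ×
       (∀ j (f : X ⇒ F₀ D j) → w (ψ K j ∘ f) ≈S φ j f) ×
       (∀ (v : X ⇒ N K → |S|) →
          (∀ {f g : X ⇒ N K} → f ≈ g → v f ≈S v g) →
          (∀ j (f : X ⇒ F₀ D j) → v (ψ K j ∘ f) ≈S φ j f) →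
          ∀ (f : X ⇒ N K) → v f ≈S w f))

_∘F_ : ∀ {o″ ℓ″ e″ o′ ℓ′ e′ o ℓ e}
         {A : Category o″ ℓ″ e″} {B : Category o′ ℓ′ e′} {C : Category o ℓ e} →
         Functor B C → Functor A B → Functor A C
_∘F_ {C = C} G F = record
  { F₀ = λ a → G.F₀ (F.F₀ a)
  ; F₁ = λ u → G.F₁ (F.F₁ u)
  ; identity = trans (G.F-resp-≈ F.identity) G.identity
  ; homomorphism = trans (G.F-resp-≈ F.homomorphism) G.homomorphism
  ; F-resp-≈ = λ p → G.F-resp-≈ (F.F-resp-≈ p)
  }
  where
    module G = Functor G
    module F = Functor F
    open Category.Equivalence C

mapCocone : ∀ {o′ ℓ′ e′ o ℓ e} {J : Category o′ ℓ′ e′} {C : Category o ℓ e}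
            (H : Functor C C) {D : Functor J C} → Cocone D → Cocone (H ∘F D)
mapCocone {C = C} H K = record
  { N = F₀ H (N K)
  ; ψ = λ j → F₁ H (ψ K j)
  ; commute = λ u → trans (sym (homomorphism H)) (F-resp-≈ H (commute K u))
  }
  where open Functor; open Cocone; open Category.Equivalence C

SmallCat : Set₁
SmallCat = Category 0ℓ 0ℓ 0ℓ

module _ (J : SmallCat) where
  open Category J

  IsFiltered : Set
  IsFiltered =
    Obj ×
    (∀ i j → Σ[ k ∈ Obj ] ((i ⇒ k) × (j ⇒ k))) ×
    (∀ {i j} (f g : i ⇒ j) → Σ[ k ∈ Obj ] Σ[ h ∈ j ⇒ k ] (h ∘ f ≈ h ∘ g))

  -- a directed (pre)ordered set viewed as a thin filtered category
  IsDirected : Set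
  IsDirected = IsFiltered × (∀ {i j} (f g : i ⇒ j) → f ≈ g)

module _ {o ℓ e : Level} (C : Category o ℓ e) where
  open Category C

  IsFP : Obj → Set (lsuc 0ℓ ⊔ o ⊔ lsuc (ℓ ⊔ e))
  IsFP X = ∀ (J : SmallCat) → IsFiltered J → (D : Functor J C) →
           (K : Cocone D) → IsColimit K → HomPreservesColimit X K

  IsFG : Obj → Set (lsuc 0ℓ ⊔ o ⊔ lsuc (ℓ ⊔ e))
  IsFG X = ∀ (J : SmallCat) → IsDirected J → (D : Functor J C) →
           (∀ {i j} (u : Category._⇒_ J i j) → Mono C (Functor.F₁ D u)) →
           (K : Cocone D) → IsColimit K → HomPreservesColimit X K

  IsCocomplete : Set (lsuc 0ℓ ⊔ o ⊔ ℓ ⊔ e)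
  IsCocomplete = ∀ (J : SmallCat) (D : Functor J C) →
                 Σ[ K ∈ Cocone D ] IsColimit K

  IsLFP : Set (lsuc 0ℓ ⊔ o ⊔ lsuc (ℓ ⊔ e))
  IsLFP =
    IsCocomplete ×
    Σ[ I ∈ Set ] Σ[ G ∈ (I → Obj) ]
      ((∀ i → IsFP (G i)) ×
       (∀ X → Σ[ J ∈ SmallCat ] (IsFiltered J ×
              Σ[ D ∈ Functor J C ] Σ[ d ∈ (Category.Obj J → I) ]
                ((∀ j → Functor.F₀ D j ≡ G (d j)) ×
                 Σ[ K ∈ Cocone D ] (IsColimit K × Cocone.N K ≡ X)))))

  IsFinitary : Functor C C → Set (lsuc 0ℓ ⊔ o ⊔ ℓ ⊔ e)
  IsFinitary H = ∀ (J : SmallCat) → IsFiltered J → (D : Functor J C) →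
                 (K : Cocone D) → IsColimit K → IsColimit (mapCocone H K)

  PreservesNonEmptyMonos : Functor C C → Set (o ⊔ ℓ ⊔ e)
  PreservesNonEmptyMonos H =
    ∀ {A B} (m : A ⇒ B) → NonEmptyMono C m → Mono C (Functor.F₁ H m)

  PreservesStrongEpis : Functor C C → Set (o ⊔ ℓ ⊔ e)
  PreservesStrongEpis H =
    ∀ {A B} (p : A ⇒ B) → StrongEpi C p → StrongEpi C (Functor.F₁ H p)

  record Coalgebra (H : Functor C C) : Set (o ⊔ ℓ) where
    field
      carrier   : Obj
      structure : carrier ⇒ Functor.F₀ H carrier

  IsCoalgebraHom : (H : Functor C C) (A B : Coalgebra H) →
                   Coalgebra.carrier A ⇒ Coalgebra.carrier B → Set e
  IsCoalgebraHom H A B h =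
    Coalgebra.structure B ∘ h ≈ Functor.F₁ H h ∘ Coalgebra.structure A

-- An fg object B is the colimit of a filtered diagram of fp objects D j. Each
-- injection D j → B factors as a strong epimorphism followed by a monomorphism:
-- coequalize all pairs of maps from projectives that D j → B identifies; the
-- projectives covering the generators detect that the induced map to B is monic.
-- These images form a directed diagram of monomorphisms with colimit B, so by
-- finite generation id_B factors through one of them, which is then invertible.
-- Hence B is a strong quotient h : P ↠ B of an fp projective P, and projectivity
-- of P lifts β ∘ h along the strong epimorphism H h to a structure P → H P.
module Submission where

open import Defs
open import Level using (Level; _⊔_; 0ℓ)
open import Data.Maybe using (Maybe; just; nothing)
open import Data.Product using (Σ; _×_; Σ-syntax; _,_; proj₁; proj₂)
open import Data.Unit using (⊤; tt)
open import Relation.Binary using (Setoid)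
open import Relation.Binary.PropositionalEquality as ≡ using (_≡_; refl)
import Relation.Binary.Reasoning.Setoid as SetoidReasoning

module HomReasoning {o ℓ e : Level} (C : Category o ℓ e) where
  open Category C
  open Equivalence public renaming (refl to ≈-refl; sym to ≈-sym; trans to ≈-trans)

  module _ {A B : Obj} where
    open SetoidReasoning (homSetoid A B) public

  ∘-resp-≈ˡ : ∀ {A B D} {f h : B ⇒ D} {g : A ⇒ B} → f ≈ h → f ∘ g ≈ h ∘ g
  ∘-resp-≈ˡ p = ∘-resp-≈ p ≈-refl

  ∘-resp-≈ʳ : ∀ {A B D} {f : B ⇒ D} {g i : A ⇒ B} → g ≈ i → f ∘ g ≈ f ∘ i
  ∘-resp-≈ʳ p = ∘-resp-≈ ≈-refl p

  sym-assoc : ∀ {A B D E} {f : A ⇒ B} {g : B ⇒ D} {h : D ⇒ E} →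
              h ∘ (g ∘ f) ≈ (h ∘ g) ∘ f
  sym-assoc = ≈-sym assoc

module StrongEpis {o ℓ e : Level} (C : Category o ℓ e) where
  open Category C
  open HomReasoning C

  strongEpi-∘ : ∀ {A B D} {p : A ⇒ B} {q : B ⇒ D} →
                StrongEpi C p → StrongEpi C q → StrongEpi C (q ∘ p)
  strongEpi-∘ {p = p} {q} (p-epi , p-lift) (q-epi , q-lift) = epi , lift
    where
    epi : Epi C (q ∘ p)
    epi g h gqp≈hqp = q-epi g h (p-epi (g ∘ q) (h ∘ q) (≈-trans assoc (≈-trans gqp≈hqp sym-assoc)))

    lift : ∀ {X Y} (m : X ⇒ Y) → Mono C m → (f : _ ⇒ X) (g : _ ⇒ Y) →
           g ∘ (q ∘ p) ≈ m ∘ f → Σ[ d ∈ _ ⇒ X ] ((d ∘ (q ∘ p) ≈ f) × (m ∘ d ≈ g))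
    lift m m-mono f g square with p-lift m m-mono f (g ∘ q) (≈-trans assoc square)
    ... | d₁ , d₁p≈f , md₁≈gq with q-lift m m-mono d₁ g (≈-sym md₁≈gq)
    ... | d₂ , d₂q≈d₁ , md₂≈g = d₂ , ≈-trans sym-assoc (≈-trans (∘-resp-≈ˡ d₂q≈d₁) d₁p≈f) , md₂≈g

  strongEpi-resp-≈ : ∀ {A B} {f g : A ⇒ B} → f ≈ g → StrongEpi C f → StrongEpi C g
  strongEpi-resp-≈ {f = f} {g} f≈g (f-epi , f-lift) = epi , lift
    where
    epi : Epi C g
    epi u v ug≈vg = f-epi u v (≈-trans (∘-resp-≈ʳ f≈g) (≈-trans ug≈vg (∘-resp-≈ʳ (≈-sym f≈g))))

    lift : ∀ {X Y} (m : X ⇒ Y) → Mono C m → (u : _ ⇒ X) (v : _ ⇒ Y) →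
           v ∘ g ≈ m ∘ u → Σ[ d ∈ _ ⇒ X ] ((d ∘ g ≈ u) × (m ∘ d ≈ v))
    lift m m-mono u v square with f-lift m m-mono u v (≈-trans (∘-resp-≈ʳ f≈g) square)
    ... | d , df≈u , md≈v = d , ≈-trans (∘-resp-≈ʳ (≈-sym f≈g)) df≈u , md≈v

  isIso⇒strongEpi : ∀ {A B} {f : A ⇒ B} → IsIso C f → StrongEpi C f
  isIso⇒strongEpi {f = f} (f⁻¹ , f⁻¹f≈id , ff⁻¹≈id) = epi , lift
    where
    cancel : ∀ {X} {u : _ ⇒ X} → (u ∘ f) ∘ f⁻¹ ≈ u
    cancel {u = u} = begin
      (u ∘ f) ∘ f⁻¹  ≈⟨ assoc ⟩
      u ∘ (f ∘ f⁻¹)  ≈⟨ ∘-resp-≈ʳ ff⁻¹≈id ⟩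
      u ∘ id         ≈⟨ identityʳ ⟩
      u              ∎

    epi : Epi C f
    epi u v uf≈vf = ≈-trans (≈-sym cancel) (≈-trans (∘-resp-≈ˡ uf≈vf) cancel)

    lift : ∀ {X Y} (m : X ⇒ Y) → Mono C m → (u : _ ⇒ X) (v : _ ⇒ Y) →
           v ∘ f ≈ m ∘ u → Σ[ d ∈ _ ⇒ X ] ((d ∘ f ≈ u) × (m ∘ d ≈ v))
    lift m _ u v square = u ∘ f⁻¹ , uf⁻¹f≈u , (begin
      m ∘ (u ∘ f⁻¹)  ≈⟨ sym-assoc ⟩
      (m ∘ u) ∘ f⁻¹  ≈⟨ ∘-resp-≈ˡ square ⟨
      (v ∘ f) ∘ f⁻¹  ≈⟨ cancel ⟩
      v              ∎)
      where
      uf⁻¹f≈u : (u ∘ f⁻¹) ∘ f ≈ u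
      uf⁻¹f≈u = ≈-trans assoc (≈-trans (∘-resp-≈ʳ f⁻¹f≈id) identityʳ)

  mono×section⇒isIso : ∀ {A B} {m : A ⇒ B} {s : B ⇒ A} → Mono C m → m ∘ s ≈ id → IsIso C m
  mono×section⇒isIso {m = m} {s} m-mono ms≈id = s , m-mono (s ∘ m) id msm≈m , ms≈id
    where
    msm≈m : m ∘ (s ∘ m) ≈ m ∘ id
    msm≈m = begin
      m ∘ (s ∘ m)  ≈⟨ sym-assoc ⟩
      (m ∘ s) ∘ m  ≈⟨ ∘-resp-≈ˡ ms≈id ⟩
      id ∘ m       ≈⟨ identityˡ ⟩
      m            ≈⟨ identityʳ ⟨
      m ∘ id       ∎

module Factorizations {o ℓ e : Level} (C : Category o ℓ e) where
  open Category C

  record Image {A B : Obj} (f : A ⇒ B) : Set (o ⊔ ℓ ⊔ e) where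
    field
      obj             : Obj
      cover           : A ⇒ obj
      inclusion       : obj ⇒ B
      cover-strongEpi : StrongEpi C cover
      inclusion-mono  : Mono C inclusion
      factorizes      : inclusion ∘ cover ≈ f

  HasImages : Set (o ⊔ ℓ ⊔ e)
  HasImages = ∀ {A B} (f : A ⇒ B) → Image f

module Separation {o ℓ e : Level} (C : Category o ℓ e) where
  open Category C
  open HomReasoning C

  Separating : {I : Set} → (I → Obj) → Set (o ⊔ ℓ ⊔ e)
  Separating {I} G = ∀ {X Y} (g h : X ⇒ Y) → (∀ i (x : G i ⇒ X) → g ∘ x ≈ h ∘ x) → g ≈ h

  colimit-jointlyEpic : {J : SmallCat} {D : Functor J C} {K : Cocone D} → IsColimit K →
                        ∀ {Y} (g h : Cocone.N K ⇒ Y) →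
                        (∀ j → g ∘ Cocone.ψ K j ≈ h ∘ Cocone.ψ K j) → g ≈ h
  colimit-jointlyEpic {K = K} colimit g h gψ≈hψ =
    ≈-trans (unique g (λ _ → ≈-refl)) (≈-sym (unique h (λ j → ≈-sym (gψ≈hψ j))))
    where
    open Cocone K
    g∘K : Cocone _
    g∘K = record { N = _ ; ψ = λ j → g ∘ ψ j
                 ; commute = λ u → ≈-trans assoc (∘-resp-≈ʳ (commute u)) }

    unique : ∀ v → (∀ j → v ∘ ψ j ≈ g ∘ ψ j) → v ≈ proj₁ (colimit g∘K)
    unique = proj₂ (proj₂ (colimit g∘K))

  lfp⇒separating : (lfp : IsLFP C) → Separating (proj₁ (proj₂ (proj₂ lfp)))
  lfp⇒separating (_ , _ , G , _ , presentation) {X} g h agree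
    with presentation X
  ... | _ , _ , D , d , D≡G , K , colimit , refl =
    colimit-jointlyEpic {K = K} colimit g h (λ j → agree-on (D≡G j) (Cocone.ψ K j))
    where
    agree-on : ∀ {i Z} → Z ≡ G i → (x : Z ⇒ X) → g ∘ x ≈ h ∘ x
    agree-on {i} refl = agree i

  separating-precomposeEpis : {I : Set} {G P : I → Obj} (p : ∀ i → P i ⇒ G i) →
                              (∀ i → Epi C (p i)) → Separating G → Separating P
  separating-precomposeEpis p p-epi G-separating g h agree =
    G-separating g h λ i x → p-epi i (g ∘ x) (h ∘ x) (begin
      (g ∘ x) ∘ p i  ≈⟨ assoc ⟩
      g ∘ (x ∘ p i)  ≈⟨ agree i (x ∘ p i) ⟩
      h ∘ (x ∘ p i)  ≈⟨ sym-assoc ⟩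
      (h ∘ x) ∘ p i  ∎)

-- The shape whose colimits are joint coequalizers of pairs indexed by T: the
-- object nothing carries the common codomain, just t the domain of the t-th pair.
module ParallelPairs (T : Set) where
  data Arrow : Maybe T → Maybe T → Set where
    idA         : ∀ {x} → Arrow x x
    left right : ∀ t → Arrow (just t) nothing

  _∙_ : ∀ {x y z} → Arrow y z → Arrow x y → Arrow x z
  g ∙ idA = g
  idA ∙ left t = left t
  idA ∙ right t = right t

  ∙-identityˡ : ∀ {x y} (f : Arrow x y) → idA ∙ f ≡ f
  ∙-identityˡ idA = refl
  ∙-identityˡ (left t) = refl
  ∙-identityˡ (right t) = refl

  ∙-assoc : ∀ {w x y z} (f : Arrow w x) (g : Arrow x y) (h : Arrow y z) →
            (h ∙ g) ∙ f ≡ h ∙ (g ∙ f)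
  ∙-assoc idA g h = refl
  ∙-assoc (left t) idA idA = refl
  ∙-assoc (right t) idA idA = refl

  shape : SmallCat
  shape = record
    { Obj = Maybe T ; _⇒_ = Arrow ; _≈_ = _≡_ ; id = idA ; _∘_ = _∙_
    ; assoc = λ {f = f} {g} {h} → ∙-assoc f g h
    ; identityˡ = λ {f = f} → ∙-identityˡ f
    ; identityʳ = refl
    ; equiv = ≡.isEquivalence
    ; ∘-resp-≈ = ≡.cong₂ _∙_
    }

module JointCoequalizer {o : Level} (C : Category o 0ℓ 0ℓ) (cocomplete : IsCocomplete C)
  {T : Set} {A : Category.Obj C} {P : T → Category.Obj C}
  (a b : ∀ t → Category._⇒_ C (P t) A) where
  open Category C
  open HomReasoning C
  open ParallelPairs T

  private
    F₀ : Maybe T → Obj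
    F₀ nothing = A
    F₀ (just t) = P t

    F₁ : ∀ {x y} → Arrow x y → F₀ x ⇒ F₀ y
    F₁ idA = id
    F₁ (left t) = a t
    F₁ (right t) = b t

    F-homomorphism : ∀ {x y z} (f : Arrow x y) (g : Arrow y z) → F₁ (g ∙ f) ≈ F₁ g ∘ F₁ f
    F-homomorphism idA g = ≈-sym identityʳ
    F-homomorphism (left t) idA = ≈-sym identityˡ
    F-homomorphism (right t) idA = ≈-sym identityˡ

    F-resp-≡ : ∀ {x y} {f g : Arrow x y} → f ≡ g → F₁ f ≈ F₁ g
    F-resp-≡ refl = ≈-refl

  diagram : Functor shape C
  diagram = record
    { F₀ = F₀ ; F₁ = F₁ ; identity = ≈-refl
    ; homomorphism = λ {f = f} {g} → F-homomorphism f g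
    ; F-resp-≈ = F-resp-≡
    }

  Coequalizes : ∀ {Y} → A ⇒ Y → Set
  Coequalizes f = ∀ t → f ∘ a t ≈ f ∘ b t

  coequalizingCocone : ∀ {Y} (f : A ⇒ Y) → Coequalizes f → Cocone diagram
  coequalizingCocone {Y} f f-coeq = record { N = Y ; ψ = ψ ; commute = commute }
    where
    ψ : ∀ x → F₀ x ⇒ Y
    ψ nothing = f
    ψ (just t) = f ∘ a t

    commute : ∀ {x y} (u : Arrow x y) → ψ y ∘ F₁ u ≈ ψ x
    commute idA = identityʳ
    commute (left t) = ≈-refl
    commute (right t) = ≈-sym (f-coeq t)

  private
    colimit : Σ[ K ∈ Cocone diagram ] IsColimit K
    colimit = cocomplete shape diagram
    module K = Cocone (proj₁ colimit)

  Q : Obj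
  Q = K.N

  coeq : A ⇒ Q
  coeq = K.ψ nothing

  coeq-coequalizes : Coequalizes coeq
  coeq-coequalizes t = ≈-trans (K.commute (left t)) (≈-sym (K.commute (right t)))

  universal : ∀ {Y} (f : A ⇒ Y) → Coequalizes f →
              Σ[ u ∈ Q ⇒ Y ] ((u ∘ coeq ≈ f) × (∀ v → v ∘ coeq ≈ f → v ≈ u))
  universal f f-coeq with proj₂ colimit (coequalizingCocone f f-coeq)
  ... | u , u-factors , unique =
    u , u-factors nothing , λ v v-factors → unique v (agrees v v-factors)
    where
    agrees : ∀ v → v ∘ coeq ≈ f → ∀ x → v ∘ K.ψ x ≈ Cocone.ψ (coequalizingCocone f f-coeq) x
    agrees v v-factors nothing = v-factors
    agrees v v-factors (just t) = begin
      v ∘ K.ψ (just t)       ≈⟨ ∘-resp-≈ʳ (K.commute (left t)) ⟨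
      v ∘ (coeq ∘ a t)       ≈⟨ sym-assoc ⟩
      (v ∘ coeq) ∘ a t       ≈⟨ ∘-resp-≈ˡ v-factors ⟩
      f ∘ a t                ∎

  precompose-coequalizes : ∀ {Y} (g : Q ⇒ Y) → Coequalizes (g ∘ coeq)
  precompose-coequalizes g t =
    ≈-trans assoc (≈-trans (∘-resp-≈ʳ (coeq-coequalizes t)) sym-assoc)

  coeq-epi : Epi C coeq
  coeq-epi g h gc≈hc with universal (g ∘ coeq) (precompose-coequalizes g)
  ... | _ , _ , unique = ≈-trans (unique g ≈-refl) (≈-sym (unique h (≈-sym gc≈hc)))

  coeq-strongEpi : StrongEpi C coeq
  coeq-strongEpi = coeq-epi , lift
    where
    lift : ∀ {X Y} (m : X ⇒ Y) → Mono C m → (f : A ⇒ X) (g : Q ⇒ Y) →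
           g ∘ coeq ≈ m ∘ f → Σ[ d ∈ Q ⇒ X ] ((d ∘ coeq ≈ f) × (m ∘ d ≈ g))
    lift m m-mono f g square with universal f f-coeq
      where
      f-coeq : Coequalizes f
      f-coeq t = m-mono (f ∘ a t) (f ∘ b t) (begin
        m ∘ (f ∘ a t)       ≈⟨ sym-assoc ⟩
        (m ∘ f) ∘ a t       ≈⟨ ∘-resp-≈ˡ square ⟨
        (g ∘ coeq) ∘ a t    ≈⟨ precompose-coequalizes g t ⟩
        (g ∘ coeq) ∘ b t    ≈⟨ ∘-resp-≈ˡ square ⟩
        (m ∘ f) ∘ b t       ≈⟨ assoc ⟩
        m ∘ (f ∘ b t)       ∎)
    ... | d , d-factors , _ = d , d-factors , coeq-epi (m ∘ d) g (begin
      (m ∘ d) ∘ coeq  ≈⟨ assoc ⟩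
      m ∘ (d ∘ coeq)  ≈⟨ ∘-resp-≈ʳ d-factors ⟩
      m ∘ f           ≈⟨ square ⟨
      g ∘ coeq        ∎)

module Images {o : Level} (C : Category o 0ℓ 0ℓ) (cocomplete : IsCocomplete C)
  {I : Set} (P : I → Category.Obj C) (P-projective : ∀ i → Projective C (P i))
  (P-separating : Separation.Separating C P) where
  open Category C
  open HomReasoning C
  open Factorizations C

  module ImageOf {A B : Obj} (f : A ⇒ B) where
    Kernel : Set
    Kernel = Σ[ i ∈ I ] Σ[ a ∈ P i ⇒ A ] Σ[ b ∈ P i ⇒ A ] (f ∘ a ≈ f ∘ b)

    kernelDomain : Kernel → Obj
    kernelDomain k = P (proj₁ k)

    kernelLeft kernelRight : ∀ k → kernelDomain k ⇒ A
    kernelLeft k = proj₁ (proj₂ k)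
    kernelRight k = proj₁ (proj₂ (proj₂ k))

    open JointCoequalizer C cocomplete kernelLeft kernelRight public

    f-coequalizes : Coequalizes f
    f-coequalizes k = proj₂ (proj₂ (proj₂ k))

    inclusion : Q ⇒ B
    inclusion = proj₁ (universal f f-coequalizes)

    factorizes : inclusion ∘ coeq ≈ f
    factorizes = proj₁ (proj₂ (universal f f-coequalizes))

    f-through-coeq : ∀ {Z} {c : Z ⇒ A} {y : Z ⇒ Q} → coeq ∘ c ≈ y → f ∘ c ≈ inclusion ∘ y
    f-through-coeq {c = c} {y} coeq∘c≈y = begin
      f ∘ c                  ≈⟨ ∘-resp-≈ˡ factorizes ⟨
      (inclusion ∘ coeq) ∘ c ≈⟨ assoc ⟩
      inclusion ∘ (coeq ∘ c) ≈⟨ ∘-resp-≈ʳ coeq∘c≈y ⟩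
      inclusion ∘ y          ∎

    lifts-identified : ∀ {i} {a b : P i ⇒ A} {y z : P i ⇒ Q} → coeq ∘ a ≈ y → coeq ∘ b ≈ z →
                       inclusion ∘ y ≈ inclusion ∘ z → y ≈ z
    lifts-identified {i} {a} {b} {y} {z} coeq∘a≈y coeq∘b≈z iy≈iz = begin
      y         ≈⟨ coeq∘a≈y ⟨
      coeq ∘ a  ≈⟨ coeq-coequalizes (i , a , b , fa≈fb) ⟩
      coeq ∘ b  ≈⟨ coeq∘b≈z ⟩
      z         ∎
      where
      fa≈fb : f ∘ a ≈ f ∘ b
      fa≈fb = ≈-trans (f-through-coeq coeq∘a≈y) (≈-trans iy≈iz (≈-sym (f-through-coeq coeq∘b≈z)))

    inclusion-mono : Mono C inclusion
    inclusion-mono g h ig≈ih = P-separating g h λ i x →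
      lifts-identified (proj₂ (lift i (g ∘ x))) (proj₂ (lift i (h ∘ x)))
                       (≈-trans sym-assoc (≈-trans (∘-resp-≈ˡ ig≈ih) assoc))
      where
      lift : ∀ i (y : P i ⇒ Q) → Σ[ a ∈ P i ⇒ A ] (coeq ∘ a ≈ y)
      lift i = P-projective i coeq coeq-strongEpi

  hasImages : HasImages
  hasImages f = record
    { obj = Q ; cover = coeq ; inclusion = inclusion
    ; cover-strongEpi = coeq-strongEpi ; inclusion-mono = inclusion-mono
    ; factorizes = factorizes
    }
    where open ImageOf f

thin : SmallCat → SmallCat
thin J = record
  { Obj = Obj ; _⇒_ = _⇒_ ; _≈_ = λ _ _ → ⊤ ; id = id ; _∘_ = _∘_
  ; assoc = tt ; identityˡ = tt ; identityʳ = tt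
  ; equiv = record { refl = tt ; sym = λ _ → tt ; trans = λ _ _ → tt }
  ; ∘-resp-≈ = λ _ _ → tt
  }
  where open Category J

filtered⇒thin-directed : (J : SmallCat) → IsFiltered J → IsDirected (thin J)
filtered⇒thin-directed J (j , cospan , _) =
  (j , cospan , λ {_} {k} _ _ → k , Category.id J , tt) , λ _ _ → tt

module HomColimits {o ℓ e : Level} (C : Category o ℓ e)
  {J : SmallCat} {D : Functor J C} (K : Cocone D) where
  open Category C
  open HomReasoning C
  open Cocone K
  private
    module D = Functor D

  -- Pairs (j , g) identified along the cocone form a cocone of hom-setoids; the
  -- induced w : C(X, N) → Σ j C(X, D j) is a section of composition with ψ,
  -- since both f ↦ f and f ↦ ψ ∘ w f are mediating maps into C(X, N).
  homColimit-factorization : ∀ {X} → HomPreservesColimit X K →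
                             (f : X ⇒ N) → Σ[ j ∈ Category.Obj J ] Σ[ g ∈ X ⇒ D.F₀ j ] (ψ j ∘ g ≈ f)
  homColimit-factorization {X} preserves f
    with preserves Presented (λ j g → j , g) (λ _ → ∘-resp-≈ʳ) pushforward
       | preserves (homSetoid X N) (λ j g → ψ j ∘ g) (λ _ → ∘-resp-≈ʳ) pushforward
    where
    Presented : Setoid ℓ e
    Presented = record
      { Carrier = Σ[ j ∈ Category.Obj J ] (X ⇒ D.F₀ j)
      ; _≈_ = λ (j , g) (k , h) → ψ j ∘ g ≈ ψ k ∘ h
      ; isEquivalence = record { refl = ≈-refl ; sym = ≈-sym ; trans = ≈-trans }
      }

    pushforward : ∀ {i j} (u : Category._⇒_ J i j) (g : X ⇒ D.F₀ i) → ψ j ∘ (D.F₁ u ∘ g) ≈ ψ i ∘ g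
    pushforward u g = ≈-trans sym-assoc (∘-resp-≈ˡ (commute u))
  ... | w , w-resp , w-ψ , _ | _ , _ , _ , unique =
    proj₁ (w f) , proj₂ (w f) ,
    ≈-trans (unique (λ g → ψ (proj₁ (w g)) ∘ proj₂ (w g)) w-resp w-ψ f)
            (≈-sym (unique (λ g → g) (λ g≈h → g≈h) (λ _ _ → ≈-refl) f))

module FilteredImages {o ℓ e : Level} (C : Category o ℓ e)
  (images : Factorizations.HasImages C)
  {J : SmallCat} (filtered : IsFiltered J) {D : Functor J C}
  (K : Cocone D) (colimit : IsColimit K) where
  open Category C
  open HomReasoning C
  open StrongEpis C
  private
    module J = Category J
    module D = Functor D
    module K = Cocone K
    module ImageOf j = Factorizations.Image (images (K.ψ j))

  Im : J.Obj → Obj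
  Im j = ImageOf.obj j

  cover : ∀ j → D.F₀ j ⇒ Im j
  cover = ImageOf.cover

  incl : ∀ j → Im j ⇒ K.N
  incl = ImageOf.inclusion

  incl-mono : ∀ j → Mono C (incl j)
  incl-mono = ImageOf.inclusion-mono

  cover-strongEpi : ∀ j → StrongEpi C (cover j)
  cover-strongEpi = ImageOf.cover-strongEpi

  cover-epi : ∀ j → Epi C (cover j)
  cover-epi j = proj₁ (cover-strongEpi j)

  incl∘cover : ∀ j → incl j ∘ cover j ≈ K.ψ j
  incl∘cover = ImageOf.factorizes

  connecting-square : ∀ {j k} (u : j J.⇒ k) → incl j ∘ cover j ≈ incl k ∘ (cover k ∘ D.F₁ u)
  connecting-square {j} {k} u = begin
    incl j ∘ cover j             ≈⟨ incl∘cover j ⟩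
    K.ψ j                        ≈⟨ K.commute u ⟨
    K.ψ k ∘ D.F₁ u               ≈⟨ ∘-resp-≈ˡ (incl∘cover k) ⟨
    (incl k ∘ cover k) ∘ D.F₁ u  ≈⟨ assoc ⟩
    incl k ∘ (cover k ∘ D.F₁ u)  ∎

  connecting-fillIn : ∀ {j k} (u : j J.⇒ k) →
                      Σ[ d ∈ Im j ⇒ Im k ]
                        ((d ∘ cover j ≈ cover k ∘ D.F₁ u) × (incl k ∘ d ≈ incl j))
  connecting-fillIn {j} {k} u =
    proj₂ (cover-strongEpi j) (incl k) (incl-mono k)
          (cover k ∘ D.F₁ u) (incl j) (connecting-square u)

  connecting : ∀ {j k} → j J.⇒ k → Im j ⇒ Im k
  connecting u = proj₁ (connecting-fillIn u)

  connecting∘cover : ∀ {j k} (u : j J.⇒ k) → connecting u ∘ cover j ≈ cover k ∘ D.F₁ u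
  connecting∘cover u = proj₁ (proj₂ (connecting-fillIn u))

  incl∘connecting : ∀ {j k} (u : j J.⇒ k) → incl k ∘ connecting u ≈ incl j
  incl∘connecting u = proj₂ (proj₂ (connecting-fillIn u))

  connecting-mono : ∀ {j k} (u : j J.⇒ k) → Mono C (connecting u)
  connecting-mono {j} {k} u g h cg≈ch = incl-mono j g h (begin
    incl j ∘ g                   ≈⟨ ∘-resp-≈ˡ (incl∘connecting u) ⟨
    (incl k ∘ connecting u) ∘ g  ≈⟨ assoc ⟩
    incl k ∘ (connecting u ∘ g)  ≈⟨ ∘-resp-≈ʳ cg≈ch ⟩
    incl k ∘ (connecting u ∘ h)  ≈⟨ sym-assoc ⟩
    (incl k ∘ connecting u) ∘ h  ≈⟨ ∘-resp-≈ˡ (incl∘connecting u) ⟩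
    incl j ∘ h                   ∎)

  -- All functor laws hold after composing with the monomorphisms incl.
  imageDiagram : Functor (thin J) C
  imageDiagram = record
    { F₀ = Im ; F₁ = connecting
    ; identity = λ {j} → incl-mono j _ _ (≈-trans (incl∘connecting J.id) (≈-sym identityʳ))
    ; homomorphism = λ {_} {_} {z} {f} {g} → incl-mono z _ _ (begin
        incl z ∘ connecting (g J.∘ f)            ≈⟨ incl∘connecting (g J.∘ f) ⟩
        incl _                                   ≈⟨ incl∘connecting f ⟨
        incl _ ∘ connecting f                    ≈⟨ ∘-resp-≈ˡ (incl∘connecting g) ⟨
        (incl z ∘ connecting g) ∘ connecting f   ≈⟨ assoc ⟩
        incl z ∘ (connecting g ∘ connecting f)   ∎)
    ; F-resp-≈ = λ {_} {k} {f} {g} _ →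
        incl-mono k _ _ (≈-trans (incl∘connecting f) (≈-sym (incl∘connecting g)))
    }

  imageCocone : Cocone imageDiagram
  imageCocone = record { N = K.N ; ψ = incl ; commute = incl∘connecting }

  imageCocone-colimit : IsColimit imageCocone
  imageCocone-colimit L = u , u∘incl , unique
    where
    module L = Cocone L
    L∘cover : Cocone D
    L∘cover = record
      { N = L.N ; ψ = λ j → L.ψ j ∘ cover j
      ; commute = λ {j} {k} u → begin
          (L.ψ k ∘ cover k) ∘ D.F₁ u        ≈⟨ assoc ⟩
          L.ψ k ∘ (cover k ∘ D.F₁ u)        ≈⟨ ∘-resp-≈ʳ (connecting∘cover u) ⟨
          L.ψ k ∘ (connecting u ∘ cover j)  ≈⟨ sym-assoc ⟩
          (L.ψ k ∘ connecting u) ∘ cover j  ≈⟨ ∘-resp-≈ˡ (L.commute u) ⟩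
          L.ψ j ∘ cover j                   ∎
      }

    u : K.N ⇒ L.N
    u = proj₁ (colimit L∘cover)

    u∘incl : ∀ j → u ∘ incl j ≈ L.ψ j
    u∘incl j = cover-epi j _ _ (begin
      (u ∘ incl j) ∘ cover j   ≈⟨ assoc ⟩
      u ∘ (incl j ∘ cover j)   ≈⟨ ∘-resp-≈ʳ (incl∘cover j) ⟩
      u ∘ K.ψ j                ≈⟨ proj₁ (proj₂ (colimit L∘cover)) j ⟩
      L.ψ j ∘ cover j          ∎)

    unique : ∀ v → (∀ j → v ∘ incl j ≈ L.ψ j) → v ≈ u
    unique v v∘incl = proj₂ (proj₂ (colimit L∘cover)) v λ j → begin
      v ∘ K.ψ j                ≈⟨ ∘-resp-≈ʳ (incl∘cover j) ⟨
      v ∘ (incl j ∘ cover j)   ≈⟨ sym-assoc ⟩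
      (v ∘ incl j) ∘ cover j   ≈⟨ ∘-resp-≈ˡ (v∘incl j) ⟩
      L.ψ j ∘ cover j          ∎

  -- Finite generation makes id factor through some incl j, which is therefore
  -- a split epimorphic monomorphism, i.e. an isomorphism.
  fg⇒colimitInjection-strongEpi : IsFG C K.N → Σ[ j ∈ J.Obj ] StrongEpi C (K.ψ j)
  fg⇒colimitInjection-strongEpi fg =
    fromSection (HomColimits.homColimit-factorization C imageCocone
                   (fg (thin J) (filtered⇒thin-directed J filtered) imageDiagram connecting-mono
                       imageCocone imageCocone-colimit) id)
    where
    fromSection : Σ[ j ∈ J.Obj ] Σ[ s ∈ K.N ⇒ Im j ] (incl j ∘ s ≈ id) →
                  Σ[ j ∈ J.Obj ] StrongEpi C (K.ψ j)
    fromSection (j , _ , incl∘s≈id) =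
      j , strongEpi-resp-≈ (incl∘cover j)
            (strongEpi-∘ (cover-strongEpi j)
                         (isIso⇒strongEpi (mono×section⇒isIso (incl-mono j) incl∘s≈id)))

module ProjectiveQuotients {o ℓ e : Level} (C : Category o ℓ e) where
  open Category C
  open StrongEpis C using (strongEpi-∘)

  EpiFromProjective : Obj → Set (o ⊔ ℓ ⊔ e)
  EpiFromProjective X = Σ[ P ∈ Obj ] (Projective C P × Σ[ p ∈ P ⇒ X ] Epi C p)

  StrongQuotientOfFPProjective : Obj → Set (Level.suc 0ℓ ⊔ o ⊔ Level.suc (ℓ ⊔ e))
  StrongQuotientOfFPProjective X =
    Σ[ P ∈ Obj ] (IsFP C P × Projective C P × Σ[ p ∈ P ⇒ X ] StrongEpi C p)

  strongQuotient⇒epiFromProjective : ∀ {X} → StrongQuotientOfFPProjective X → EpiFromProjective X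
  strongQuotient⇒epiFromProjective (P , _ , P-projective , p , p-strongEpi) =
    P , P-projective , p , proj₁ p-strongEpi

  strongQuotientOfFPProjective-∘ : ∀ {X Y} → StrongQuotientOfFPProjective Y →
                                   (q : Y ⇒ X) → StrongEpi C q → StrongQuotientOfFPProjective X
  strongQuotientOfFPProjective-∘ (P , P-fp , P-projective , p , p-strongEpi) q q-strongEpi =
    P , P-fp , P-projective , q ∘ p , strongEpi-∘ p-strongEpi q-strongEpi

module LocallyFinitelyPresentable {o : Level} (C : Category o 0ℓ 0ℓ) where
  open Category C
  open Separation C
  open ProjectiveQuotients C

  lfp⇒hasImages : IsLFP C → (∀ X → IsFP C X → EpiFromProjective X) → Factorizations.HasImages C
  lfp⇒hasImages lfp@(cocomplete , _ , G , G-fp , _) fp-covered =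
    Images.hasImages C cocomplete P P-projective
      (separating-precomposeEpis p p-epi (lfp⇒separating lfp))
    where
    P : _ → Obj
    P i = proj₁ (fp-covered (G i) (G-fp i))

    P-projective : ∀ i → Projective C (P i)
    P-projective i = proj₁ (proj₂ (fp-covered (G i) (G-fp i)))

    p : ∀ i → P i ⇒ G i
    p i = proj₁ (proj₂ (proj₂ (fp-covered (G i) (G-fp i))))

    p-epi : ∀ i → Epi C (p i)
    p-epi i = proj₂ (proj₂ (proj₂ (fp-covered (G i) (G-fp i))))

  fg⇒strongQuotientOfFP : IsLFP C → (∀ X → IsFP C X → EpiFromProjective X) →
                          ∀ X → IsFG C X → Σ[ Y ∈ Obj ] (IsFP C Y × Σ[ q ∈ Y ⇒ X ] StrongEpi C q)
  fg⇒strongQuotientOfFP lfp@(_ , _ , G , G-fp , presentation) fp-covered X fg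
    with presentation X
  ... | _ , filtered , D , d , D≡G , K , colimit , refl =
    quotient (FilteredImages.fg⇒colimitInjection-strongEpi C (lfp⇒hasImages lfp fp-covered)
                filtered K colimit fg)
    where
    quotient : Σ[ j ∈ _ ] StrongEpi C (Cocone.ψ K j) →
               Σ[ Y ∈ Obj ] (IsFP C Y × Σ[ q ∈ Y ⇒ Cocone.N K ] StrongEpi C q)
    quotient (j , ψ-strongEpi) =
      Functor.F₀ D j , ≡.subst (IsFP C) (≡.sym (D≡G j)) (G-fp (d j)) , Cocone.ψ K j , ψ-strongEpi

  fg⇒strongQuotientOfFPProjective :
    IsLFP C → (∀ X → IsFP C X → StrongQuotientOfFPProjective X) →
    ∀ X → IsFG C X → StrongQuotientOfFPProjective X
  fg⇒strongQuotientOfFPProjective lfp fp-covered X fg =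
    precompose (fg⇒strongQuotientOfFP lfp epi-covered X fg)
    where
    epi-covered : ∀ Y → IsFP C Y → EpiFromProjective Y
    epi-covered Y Y-fp = strongQuotient⇒epiFromProjective (fp-covered Y Y-fp)

    precompose : Σ[ Y ∈ Obj ] (IsFP C Y × Σ[ q ∈ Y ⇒ X ] StrongEpi C q) →
                 StrongQuotientOfFPProjective X
    precompose (Y , Y-fp , q , q-strongEpi) =
      strongQuotientOfFPProjective-∘ (fp-covered Y Y-fp) q q-strongEpi

module Coalgebras {o ℓ e : Level} (C : Category o ℓ e) (H : Functor C C) where
  open Category C
  open Functor H
  open ProjectiveQuotients C using (StrongQuotientOfFPProjective)

  coalgebra-strongQuotientOfFP :
    PreservesStrongEpis C H → (B : Coalgebra C H) →
    StrongQuotientOfFPProjective (Coalgebra.carrier B) →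
    Σ[ A ∈ Coalgebra C H ] (IsFP C (Coalgebra.carrier A) ×
      Σ[ h ∈ Coalgebra.carrier A ⇒ Coalgebra.carrier B ] (IsCoalgebraHom C H A B h × StrongEpi C h))
  coalgebra-strongQuotientOfFP H-strongEpis B (P , P-fp , P-projective , h , h-strongEpi) =
    record { carrier = P ; structure = proj₁ lift } ,
    P-fp , h , Equivalence.sym (proj₂ lift) , h-strongEpi
    where
    lift : Σ[ α ∈ P ⇒ F₀ P ] (F₁ h ∘ α ≈ Coalgebra.structure B ∘ h)
    lift = P-projective (F₁ h) (H-strongEpis h h-strongEpi) (Coalgebra.structure B ∘ h)

open LocallyFinitelyPresentable using (fg⇒strongQuotientOfFPProjective)
open Coalgebras using (coalgebra-strongQuotientOfFP)

mainTheorem16 : {o : Level} (C : Category o Level.zero Level.zero) →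
    (H : Functor C C) →
    IsLFP C →
    IsFinitary C H →
    PreservesNonEmptyMonos C H →
    (∀ X → IsFP C X →
       Σ[ P ∈ Category.Obj C ] (IsFP C P × Projective C P ×
         Σ[ p ∈ Category._⇒_ C P X ] StrongEpi C p)) →
    PreservesStrongEpis C H →
    (B : Coalgebra C H) → IsFG C (Coalgebra.carrier B) →
    Σ[ A ∈ Coalgebra C H ] (IsFP C (Coalgebra.carrier A) ×
      Σ[ h ∈ Category._⇒_ C (Coalgebra.carrier A) (Coalgebra.carrier B) ]
        (IsCoalgebraHom C H A B h × StrongEpi C h))
mainTheorem16 C H lfp _ _ fp-covered H-strongEpis B B-fg =
  coalgebra-strongQuotientOfFP C H H-strongEpis B
    (fg⇒strongQuotientOfFPProjective C lfp fp-covered (Coalgebra.carrier B) B-fg)
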